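{- Let $G$ be a permutation group on a finite set $\Omega$ of size $n$. Then $F_G(0)=0$, $F_G(1)=|G|$, and $F_G(2)\ge(n+1)|G|$, with equality if and only if $G$ is set-transitive, i.e. $G$ is transitive on the set of $i$-element subsets of $\Omega$ for every $0\le i\le n$.
   Context: $F_G(x)=\sum_{g\in G}x^{c(g)}$, where $c(g)$ is the number of cycles of $g$ on $\Omega$ (including fixed points). -}

module Defs where

open import Data.Nat using (ℕ; zero; suc; _+_; _*_; _^_; _≤_; _<_)
open import Data.Fin using (Fin; toℕ)
open import Data.Fin.Permutation using (Permutation′; _⟨$⟩ʳ_; _≈_; id; flip; _∘ₚ_)
open import Data.Fin.Subset using (Subset; _∈_; ∣_∣)
open import Data.List using (List; []; _∷_; length; map; filter; allFin)
open import Data.Nat.ListAction using (sum)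
open import Relation.Binary.PropositionalEquality using (_≡_)
open import Data.List.Relation.Unary.Any using (Any)
open import Data.List.Relation.Unary.AllPairs using (AllPairs)
open import Data.Product using (Σ; _×_)
open import Relation.Nullary using (¬_)
open import Relation.Unary using (Decidable)
open import Data.Nat.Properties using (_≤?_)
open import Data.Fin.Properties using (all?)

iter : ∀ {n} → Permutation′ n → ℕ → Fin n → Fin n
iter g zero    i = i
iter g (suc k) i = g ⟨$⟩ʳ (iter g k i)

-- i is the least point (w.r.t. the natural order on Fin n) of its cycle under g;
-- the cycle of i is {g^k i | k < n}.
IsCycleMin : ∀ {n} → Permutation′ n → Fin n → Set
IsCycleMin {n} g i = (k : Fin n) → toℕ i ≤ toℕ (iter g (toℕ k) i)

isCycleMin? : ∀ {n} (g : Permutation′ n) → Decidable (IsCycleMin g)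
isCycleMin? g i = all? (λ k → toℕ i ≤? toℕ (iter g (toℕ k) i))

-- c(g): number of cycles of g on Fin n (fixed points included);
-- counted as the number of cycles, each represented by its least element.
cycles : ∀ {n} → Permutation′ n → ℕ
cycles {n} g = length (filter (isCycleMin? g) (allFin n))

_∈G_ : ∀ {n} → Permutation′ n → List (Permutation′ n) → Set
σ ∈G G = Any (λ τ → τ ≈ σ) G

record IsPermGroup {n : ℕ} (G : List (Permutation′ n)) : Set where
  field
    distinct : AllPairs (λ σ τ → ¬ (σ ≈ τ)) G
    hasId    : id ∈G G
    closed∘  : ∀ σ τ → σ ∈G G → τ ∈G G → (σ ∘ₚ τ) ∈G G
    closed⁻¹ : ∀ σ → σ ∈G G → flip σ ∈G G

order : ∀ {n} → List (Permutation′ n) → ℕ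
order G = length G

F : ∀ {n} → List (Permutation′ n) → ℕ → ℕ
F G x = sum (map (λ g → x ^ cycles g) G)

MapsOnto : ∀ {n} → Permutation′ n → Subset n → Subset n → Set
MapsOnto σ A B = ∀ x → (x ∈ A → (σ ⟨$⟩ʳ x) ∈ B) × ((σ ⟨$⟩ʳ x) ∈ B → x ∈ A)

SetTransitive : ∀ {n} → List (Permutation′ n) → Set
SetTransitive {n} G =
  ∀ (i : ℕ) → i ≤ n → ∀ (A B : Subset n) → ∣ A ∣ ≡ i → ∣ B ∣ ≡ i →
    Σ (Permutation′ n) (λ σ → σ ∈G G × MapsOnto σ A B)

module Submission where

-- A subset of Ω is fixed by σ iff it is a union of cycles of σ, so σ fixes exactly 2^c(σ)
-- subsets and F_G(2) = Σ_σ #Fix(σ) = Σ_A |G_A|, summing the stabilisers of all subsets A.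
-- Since A ↦ σ⁻¹A is a size-preserving bijection and there are n + 1 initial segments
-- I_i = {0, …, i − 1}, exactly n + 1 subsets A satisfy σ⁻¹A = I_|A|; hence
-- (n + 1)|G| = Σ_A #{σ ∈ G | σ⁻¹A = I_|A|}.  The set counted on the right is empty or a coset
-- of G_A, so each term is at most |G_A|, with equality for every A iff every A lies in the orbit
-- of I_|A|, i.e. iff G is set-transitive.  F_G(0) = 0 because every permutation has a cycle.

open import Defs
open import Data.Bool.Base using (Bool; true; false; if_then_else_)
import Data.Bool.Properties as Bool
open import Data.Empty using (⊥-elim)
open import Data.Fin.Base as Fin using (Fin; zero; suc; toℕ)
import Data.Fin.Properties as Finₚ
open import Data.Fin.Permutation
  using (Permutation′; _⟨$⟩ʳ_; _⟨$⟩ˡ_; flip; _∘ₚ_; inverseˡ; inverseʳ) renaming (_≈_ to _≈ₚ_)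
open import Data.Fin.Subset using (Subset; inside; outside; ∣_∣; _⊆_; _∩_; ⊥)
import Data.Fin.Subset as Subset
open import Data.Fin.Subset.Properties
  using (_⊆?_; drop-∷-⊆; out⊆; in⊆in; ∣⊥∣≡0; ∣p∣≤n; ⊆-antisym; p∩q⊆q; x∈p∩q⁺; x∈p∩q⁻)
open import Data.List.Base as List using (List; []; _∷_; length; map; filter; lookup; _++_)
open import Data.List.Properties using (map-++; map-∘; filter-accept)
open import Data.List.Relation.Unary.All as All using ([])
import Data.List.Relation.Unary.All.Properties as Allₚ
open import Data.List.Relation.Unary.AllPairs using ([]; _∷_)
open import Data.List.Relation.Unary.Any as Any using (Any; here; there)
open import Data.List.Relation.Unary.Unique.Propositional using (Unique)
import Data.List.Relation.Unary.Unique.Propositional.Properties as Uniqueₚ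
import Data.List.Relation.Unary.Unique.Setoid.Properties as UniqueSetoidₚ
open import Data.List.Membership.Propositional using (_∈_; find)
open import Data.List.Membership.Propositional.Properties
  using (∈-lookup; ∈-map⁺; ∈-map⁻; ∈-++⁺ˡ; ∈-++⁺ʳ)
import Data.List.Membership.Setoid as SetoidMembership
import Data.List.Membership.Setoid.Properties as SetoidMembershipₚ
open import Data.Nat.Base
  using (ℕ; zero; suc; _+_; _*_; _^_; _∸_; _≤_; _<_; _≥_; z≤n; s≤s; s≤s⁻¹; NonZero; >-nonZero)
open import Data.Nat.DivMod using (_%_; _/_; m≡m%n+[m/n]*n; m%n<n)
open import Data.Nat.ListAction using (sum)
open import Data.Nat.ListAction.Properties using (sum-++)
open import Data.Nat.Properties
open import Algebra.Properties.CommutativeSemigroup +-commutativeSemigroup using (interchange)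
import Algebra.Properties.CommutativeMonoid.Sum +-0-commutativeMonoid as FinSum
open import Data.List.Extrema ≤-totalOrder using (argmin; argmin-all; f[argmin]≤f[xs])
open import Data.Product.Base using (∃-syntax; _×_; _,_; proj₁; proj₂)
open import Data.Vec.Base as Vec using ([]; _∷_)
import Data.Vec.Properties as Vecₚ
open import Function.Base using (_∘_; case_of_)
open import Function.Bundles using (_⇔_; mk⇔; Equivalence)
open import Function.Construct.Composition using (_⇔-∘_)
open import Function.Construct.Symmetry using (⇔-sym)
open import Level using (0ℓ)
open import Relation.Binary.Bundles using (Setoid)
open import Relation.Binary.Definitions using (_Respects_; DecidableEquality)
open import Relation.Binary.PropositionalEquality
open import Relation.Nullary using (¬_; yes; no; does)
open import Relation.Nullary.Decidable using (dec-true; proof)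
open import Relation.Nullary.Reflects using (Reflects; invert)
open import Relation.Unary using (Pred; Decidable)

private
  variable
    A B : Set

∑ : List A → (A → ℕ) → ℕ
∑ xs f = sum (map f xs)

infix 5 ∑
syntax ∑ xs (λ x → e) = ∑[ x ∈ xs ] e

count : {P : Pred A 0ℓ} → Decidable P → List A → ℕ
count P? xs = ∑[ x ∈ xs ] (if does (P? x) then 1 else 0)

∑-cong : ∀ {f g : A → ℕ} xs → (∀ {x} → x ∈ xs → f x ≡ g x) → ∑ xs f ≡ ∑ xs g
∑-cong []       f≗g = refl
∑-cong (x ∷ xs) f≗g = cong₂ _+_ (f≗g (here refl)) (∑-cong xs (f≗g ∘ there))

∑-mono-≤ : ∀ {f g : A → ℕ} xs → (∀ x → f x ≤ g x) → ∑ xs f ≤ ∑ xs g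
∑-mono-≤ []       f≤g = z≤n
∑-mono-≤ (x ∷ xs) f≤g = +-mono-≤ (f≤g x) (∑-mono-≤ xs f≤g)

∑-const : ∀ c (xs : List A) → ∑[ _ ∈ xs ] c ≡ length xs * c
∑-const c []       = refl
∑-const c (x ∷ xs) = cong (c +_) (∑-const c xs)

∑-++ : ∀ (f : A → ℕ) xs ys → ∑ (xs ++ ys) f ≡ ∑ xs f + ∑ ys f
∑-++ f xs ys = trans (cong sum (map-++ f xs ys)) (sum-++ (map f xs) (map f ys))

∑-map : ∀ (h : B → A) (f : A → ℕ) xs → ∑ (map h xs) f ≡ ∑ xs (f ∘ h)
∑-map h f xs = cong sum (sym (map-∘ xs))

∑-distrib-+ : ∀ (f g : A → ℕ) xs → ∑[ x ∈ xs ] (f x + g x) ≡ ∑ xs f + ∑ xs g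
∑-distrib-+ f g []       = refl
∑-distrib-+ f g (x ∷ xs) =
  trans (cong (f x + g x +_) (∑-distrib-+ f g xs)) (interchange (f x) (g x) (∑ xs f) (∑ xs g))

∑-comm : ∀ (f : A → B → ℕ) xs ys →
         ∑[ x ∈ xs ] ∑[ y ∈ ys ] f x y ≡ ∑[ y ∈ ys ] ∑[ x ∈ xs ] f x y
∑-comm f []       ys = trans (sym (*-zeroʳ (length ys))) (sym (∑-const 0 ys))
∑-comm f (x ∷ xs) ys = trans (cong (∑ ys (f x) +_) (∑-comm f xs ys))
                             (sym (∑-distrib-+ (f x) (λ y → ∑[ x ∈ xs ] f x y) ys))

+-mono-≤-equality : ∀ {a b c d} → a ≤ b → c ≤ d → a + c ≡ b + d → a ≡ b × c ≡ d
+-mono-≤-equality {a} {b} {c} {d} a≤b c≤d eq =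
  a≡b , +-cancelˡ-≡ a c d (trans eq (cong (_+ d) (sym a≡b)))
  where
  a≡b : a ≡ b
  a≡b = ≤-antisym a≤b (+-cancelʳ-≤ c b a (≤-trans (+-monoʳ-≤ b c≤d) (≤-reflexive (sym eq))))

∑-mono-≤-equality : ∀ {f g : A → ℕ} xs → (∀ x → f x ≤ g x) → ∑ xs f ≡ ∑ xs g →
                    ∀ {x} → x ∈ xs → f x ≡ g x
∑-mono-≤-equality (y ∷ xs) f≤g eq (here refl) =
  proj₁ (+-mono-≤-equality (f≤g y) (∑-mono-≤ xs f≤g) eq)
∑-mono-≤-equality (y ∷ xs) f≤g eq (there x∈) =
  ∑-mono-≤-equality xs f≤g (proj₂ (+-mono-≤-equality (f≤g y) (∑-mono-≤ xs f≤g) eq)) x∈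

module _ {P : Pred A 0ℓ} (P? : Decidable P) where

  count≡length-filter : ∀ xs → count P? xs ≡ length (filter P? xs)
  count≡length-filter []       = refl
  count≡length-filter (x ∷ xs) with does (P? x)
  ... | true  = cong suc (count≡length-filter xs)
  ... | false = count≡length-filter xs

  count-pos⇒Any : ∀ {xs} → 1 ≤ count P? xs → Any P xs
  count-pos⇒Any {x ∷ xs} pos with P? x
  ... | yes Px = here Px
  ... | no  _  = there (count-pos⇒Any pos)

  Any⇒count-pos : ∀ {xs} → Any P xs → 1 ≤ count P? xs
  Any⇒count-pos {x ∷ xs} any with P? x | any
  ... | yes _  | _          = s≤s z≤n
  ... | no ¬Px | here Px    = ⊥-elim (¬Px Px)
  ... | no _   | there any′ = Any⇒count-pos any′

  ¬Any⇒count≡0 : ∀ {xs} → ¬ Any P xs → count P? xs ≡ 0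
  ¬Any⇒count≡0 {[]}     _    = refl
  ¬Any⇒count≡0 {x ∷ xs} ¬any with P? x
  ... | yes Px = ⊥-elim (¬any (here Px))
  ... | no  _  = ¬Any⇒count≡0 (¬any ∘ there)

  count-cong : ∀ {Q : Pred A 0ℓ} (Q? : Decidable Q) →
               (∀ {x} → P x → Q x) → (∀ {x} → Q x → P x) →
               ∀ xs → count P? xs ≡ count Q? xs
  count-cong Q? P⇒Q Q⇒P []       = refl
  count-cong Q? P⇒Q Q⇒P (x ∷ xs) with P? x | Q? x
  ... | yes _  | yes _  = cong suc (count-cong Q? P⇒Q Q⇒P xs)
  ... | no  _  | no  _  = count-cong Q? P⇒Q Q⇒P xs
  ... | yes Px | no ¬Qx = ⊥-elim (¬Qx (P⇒Q Px))
  ... | no ¬Px | yes Qx = ⊥-elim (¬Px (Q⇒P Qx))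

Unique⇒count≡1 : (_≟_ : DecidableEquality A) → ∀ {x xs} → Unique xs → x ∈ xs →
                 count (_≟ x) xs ≡ 1
Unique⇒count≡1 _≟_ {x} (x∉ ∷ _) (here refl) with x ≟ x
... | yes _  = cong suc (¬Any⇒count≡0 (_≟ x) λ any → All.lookup x∉ (Any.map sym any) refl)
... | no x≢x = ⊥-elim (x≢x refl)
Unique⇒count≡1 _≟_ {x} {y ∷ _} (y∉ ∷ u) (there x∈) with y ≟ x
... | yes refl = ⊥-elim (All.lookup y∉ x∈ refl)
... | no  _    = Unique⇒count≡1 _≟_ u x∈

module _ (S : Setoid 0ℓ 0ℓ) where

  open Setoid S using (_≈_) renaming (Carrier to C; sym to ≈-sym)
  open SetoidMembership S using () renaming (_∈_ to _∈ₛ_)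
  open import Data.List.Relation.Unary.Unique.Setoid S using () renaming (Unique to Uniqueₛ)

  Unique⇒lookup-injective : ∀ {xs} → Uniqueₛ xs → ∀ {i j} → lookup xs i ≈ lookup xs j → i ≡ j
  Unique⇒lookup-injective (_  ∷ _) {zero}  {zero}  _  = refl
  Unique⇒lookup-injective (x≉ ∷ _) {zero}  {suc j} eq = ⊥-elim (All.lookup x≉ (∈-lookup j) eq)
  Unique⇒lookup-injective (x≉ ∷ _) {suc i} {zero}  eq =
    ⊥-elim (All.lookup x≉ (∈-lookup i) (≈-sym eq))
  Unique⇒lookup-injective (_  ∷ u) {suc i} {suc j} eq = cong suc (Unique⇒lookup-injective u eq)

  length-≤-injection : ∀ {xs ys} → Uniqueₛ xs → (f : C → C) →
                       (∀ {x} → x ∈ₛ xs → f x ∈ₛ ys) →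
                       (∀ {x y} → x ∈ₛ xs → y ∈ₛ xs → f x ≈ f y → x ≈ y) →
                       length xs ≤ length ys
  length-≤-injection {xs} {ys} u f into inj = Finₚ.injective⇒≤ h-injective
    where
    lookup∈ : ∀ i → lookup xs i ∈ₛ xs
    lookup∈ = SetoidMembershipₚ.∈-lookup S xs
    h : Fin (length xs) → Fin (length ys)
    h i = Any.index (into (lookup∈ i))
    h-injective : ∀ {i j} → h i ≡ h j → i ≡ j
    h-injective eq = Unique⇒lookup-injective u
      (inj (lookup∈ _) (lookup∈ _) (SetoidMembershipₚ.index-injective S (into _) (into _) eq))

  count-≤-injection : ∀ {P Q : Pred C 0ℓ} (P? : Decidable P) (Q? : Decidable Q) →
                      P Respects _≈_ → Q Respects _≈_ → ∀ {xs ys} → Uniqueₛ xs → (f : C → C) →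
                      (∀ {x} → x ∈ₛ xs → P x → f x ∈ₛ ys) → (∀ {x} → P x → Q (f x)) →
                      (∀ {x y} → P x → P y → f x ≈ f y → x ≈ y) → count P? xs ≤ count Q? ys
  count-≤-injection {P} P? Q? P-resp Q-resp {xs} {ys} u f into P⇒Q∘f inj = begin
    count P? xs           ≡⟨ count≡length-filter P? xs ⟩
    length (filter P? xs) ≤⟨ length-≤-injection (UniqueSetoidₚ.filter⁺ S P? u) f into′ inj′ ⟩
    length (filter Q? ys) ≡⟨ count≡length-filter Q? ys ⟨
    count Q? ys           ∎
    where
    open ≤-Reasoning
    ∈-filter⁻ : ∀ {x} → x ∈ₛ filter P? xs → x ∈ₛ xs × P x
    ∈-filter⁻ = SetoidMembershipₚ.∈-filter⁻ S P? P-resp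
    into′ : ∀ {x} → x ∈ₛ filter P? xs → f x ∈ₛ filter Q? ys
    into′ x∈ with x∈xs , Px ← ∈-filter⁻ x∈ =
      SetoidMembershipₚ.∈-filter⁺ S Q? Q-resp (into x∈xs Px) (P⇒Q∘f Px)
    inj′ : ∀ {x y} → x ∈ₛ filter P? xs → y ∈ₛ filter P? xs → f x ≈ f y → x ≈ y
    inj′ x∈ y∈ = inj (proj₂ (∈-filter⁻ x∈)) (proj₂ (∈-filter⁻ y∈))

module _ {xs : List A} (unique : Unique xs) (complete : ∀ x → x ∈ xs) where

  count-≡-inverses : ∀ {P Q : Pred A 0ℓ} (P? : Decidable P) (Q? : Decidable Q) (f g : A → A) →
                     (∀ {x} → P x → Q (f x)) → (∀ {y} → Q y → P (g y)) →
                     (∀ {x} → P x → g (f x) ≡ x) → (∀ {y} → Q y → f (g y) ≡ y) →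
                     count P? xs ≡ count Q? xs
  count-≡-inverses {P} {Q} P? Q? f g P⇒Q∘f Q⇒P∘g g∘f≡id f∘g≡id = ≤-antisym
    (count-≤-injection (setoid A) P? Q? (subst P) (subst Q) unique f (λ _ _ → complete _) P⇒Q∘f
      (λ Px Py fx≡fy → trans (sym (g∘f≡id Px)) (trans (cong g fx≡fy) (g∘f≡id Py))))
    (count-≤-injection (setoid A) Q? P? (subst Q) (subst P) unique g (λ _ _ → complete _) Q⇒P∘g
      (λ Qx Qy gx≡gy → trans (sym (f∘g≡id Qx)) (trans (cong f gx≡gy) (f∘g≡id Qy))))

-- Subsets of Fin n

subsets : ∀ n → List (Subset n)
subsets zero    = [] ∷ []
subsets (suc n) = map (inside ∷_) (subsets n) ++ map (outside ∷_) (subsets n)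

∈-subsets : ∀ {n} (p : Subset n) → p ∈ subsets n
∈-subsets []                    = here refl
∈-subsets {suc n} (inside ∷ p)  = ∈-++⁺ˡ (∈-map⁺ (inside ∷_) (∈-subsets p))
∈-subsets {suc n} (outside ∷ p) =
  ∈-++⁺ʳ (map (inside ∷_) (subsets n)) (∈-map⁺ (outside ∷_) (∈-subsets p))

subsets-unique : ∀ n → Unique (subsets n)
subsets-unique zero    = [] ∷ []
subsets-unique (suc n) = Uniqueₚ.++⁺ (Uniqueₚ.map⁺ Vecₚ.∷-injectiveʳ (subsets-unique n))
  (Uniqueₚ.map⁺ Vecₚ.∷-injectiveʳ (subsets-unique n)) inside≢outside
  where
  inside≢outside : ∀ {p} → ¬ (p ∈ map (inside ∷_) (subsets n) × p ∈ map (outside ∷_) (subsets n))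
  inside≢outside (p∈ᵢ , p∈ₒ) with ∈-map⁻ (inside ∷_) p∈ᵢ | ∈-map⁻ (outside ∷_) p∈ₒ
  ... | _ , _ , refl | _ , _ , ()

count-subsets-suc : ∀ {n} {P : Pred (Subset (suc n)) 0ℓ} (P? : Decidable P) →
                    count P? (subsets (suc n)) ≡
                      count (P? ∘ (inside ∷_)) (subsets n) + count (P? ∘ (outside ∷_)) (subsets n)
count-subsets-suc {n} P? = trans (∑-++ _ (map (inside ∷_) (subsets n)) _)
  (cong₂ _+_ (∑-map (inside ∷_) _ (subsets n)) (∑-map (outside ∷_) _ (subsets n)))

count-⊆ : ∀ {n} (q : Subset n) → count (_⊆? q) (subsets n) ≡ 2 ^ ∣ q ∣
count-⊆ []              = refl
count-⊆ {suc n} (s ∷ q) = begin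
  count (_⊆? s ∷ q) (subsets (suc n))
    ≡⟨ count-subsets-suc {n} (_⊆? s ∷ q) ⟩
  count (λ p → inside ∷ p ⊆? s ∷ q) S + count (λ p → outside ∷ p ⊆? s ∷ q) S
    ≡⟨ cong (count (λ p → inside ∷ p ⊆? s ∷ q) S +_)
         (trans (count-cong (λ p → outside ∷ p ⊆? s ∷ q) (_⊆? q) drop-∷-⊆ out⊆ S) (count-⊆ q)) ⟩
  count (λ p → inside ∷ p ⊆? s ∷ q) S + 2 ^ ∣ q ∣
    ≡⟨ by-head s ⟩
  2 ^ ∣ s ∷ q ∣ ∎
  where
  open ≡-Reasoning
  S : List (Subset n)
  S = subsets n
  by-head : ∀ s → count (λ p → inside ∷ p ⊆? s ∷ q) S + 2 ^ ∣ q ∣ ≡ 2 ^ ∣ s ∷ q ∣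
  by-head inside  = cong₂ _+_
    (trans (count-cong (λ p → inside ∷ p ⊆? inside ∷ q) (_⊆? q) drop-∷-⊆ in⊆in S) (count-⊆ q))
    (sym (+-identityʳ (2 ^ ∣ q ∣)))
  by-head outside = cong (_+ 2 ^ ∣ q ∣)
    (¬Any⇒count≡0 (λ p → inside ∷ p ⊆? outside ∷ q) {S}
       λ any → case proj₂ (Any.satisfied any) Vec.here of λ ())

_≟ₛ_ : ∀ {n} → DecidableEquality (Subset n)
_≟ₛ_ = Vecₚ.≡-dec Bool._≟_

-- For i > n this is all of Fin n.
initial : ∀ n → ℕ → Subset n
initial n       zero    = ⊥
initial zero    (suc i) = []
initial (suc n) (suc i) = inside ∷ initial n i

∣initial∣ : ∀ {n i} → i ≤ n → ∣ initial n i ∣ ≡ i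
∣initial∣ {n} z≤n   = ∣⊥∣≡0 n
∣initial∣ (s≤s i≤n) = cong suc (∣initial∣ i≤n)

IsInitial : ∀ {n} → Pred (Subset n) 0ℓ
IsInitial {n} p = p ≡ initial n ∣ p ∣

isInitial? : ∀ {n} → Decidable (IsInitial {n})
isInitial? p = p ≟ₛ initial _ ∣ p ∣

outside∷-IsInitial⇔ : ∀ {n} {p : Subset n} → IsInitial (outside ∷ p) ⇔ p ≡ ⊥
outside∷-IsInitial⇔ {n} {p} = mk⇔ to from
  where
  to : IsInitial (outside ∷ p) → p ≡ ⊥
  to eq with ∣ p ∣
  ... | zero = Vecₚ.∷-injectiveʳ eq
  to () | suc _
  from : p ≡ ⊥ → IsInitial (outside ∷ p)
  from refl rewrite ∣⊥∣≡0 n = refl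

count-IsInitial : ∀ n → count isInitial? (subsets n) ≡ suc n
count-IsInitial zero    = refl
count-IsInitial (suc n) = begin
  count isInitial? (subsets (suc n))
    ≡⟨ count-subsets-suc {n} isInitial? ⟩
  count (isInitial? ∘ (inside ∷_)) S + count (isInitial? ∘ (outside ∷_)) S
    ≡⟨ cong₂ _+_
         (count-cong (isInitial? ∘ (inside ∷_)) isInitial? Vecₚ.∷-injectiveʳ (cong (inside ∷_)) S)
         (count-cong (isInitial? ∘ (outside ∷_)) (_≟ₛ ⊥) (Equivalence.to outside∷-IsInitial⇔)
            (Equivalence.from outside∷-IsInitial⇔) S) ⟩
  count isInitial? S + count (_≟ₛ ⊥) S
    ≡⟨ cong₂ _+_ (count-IsInitial n) (Unique⇒count≡1 _≟ₛ_ (subsets-unique n) (∈-subsets ⊥)) ⟩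
  suc n + 1
    ≡⟨ +-comm (suc n) 1 ⟩
  suc (suc n) ∎
  where
  open ≡-Reasoning
  S : List (Subset n)
  S = subsets n

preimage : ∀ {m n} → (Fin m → Fin n) → Subset n → Subset m
preimage f p = Vec.tabulate (λ x → Vec.lookup p (f x))

module _ {m n : ℕ} {f : Fin m → Fin n} where

  ∈-preimage⁻ : ∀ {p x} → x Subset.∈ preimage f p → f x Subset.∈ p
  ∈-preimage⁻ {p} {x} x∈ =
    Vecₚ.lookup⇒[]= (f x) p (trans (sym (Vecₚ.lookup∘tabulate _ x)) (Vecₚ.[]=⇒lookup x∈))

  ∈-preimage⁺ : ∀ {p x} → f x Subset.∈ p → x Subset.∈ preimage f p
  ∈-preimage⁺ {p} {x} fx∈ =
    Vecₚ.lookup⇒[]= x (preimage f p) (trans (Vecₚ.lookup∘tabulate _ x) (Vecₚ.[]=⇒lookup fx∈))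

preimage-cong : ∀ {m n} {f h : Fin m → Fin n} → f ≗ h → ∀ p → preimage f p ≡ preimage h p
preimage-cong f≗h p = Vecₚ.tabulate-cong (cong (Vec.lookup p) ∘ f≗h)

preimage-id : ∀ {n} (p : Subset n) → preimage (λ x → x) p ≡ p
preimage-id = Vecₚ.tabulate∘lookup

preimage-∘ : ∀ {l m n} (f : Fin m → Fin n) (h : Fin l → Fin m) p →
             preimage (f ∘ h) p ≡ preimage h (preimage f p)
preimage-∘ f h p = Vecₚ.tabulate-cong (λ x → sym (Vecₚ.lookup∘tabulate _ (h x)))

preimage-inverse : ∀ {m n} {f : Fin m → Fin n} {h : Fin n → Fin m} → (∀ x → f (h x) ≡ x) →
                   ∀ p → preimage h (preimage f p) ≡ p
preimage-inverse {f = f} {h} f∘h≗id p = begin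
  preimage h (preimage f p) ≡⟨ preimage-∘ f h p ⟨
  preimage (f ∘ h) p        ≡⟨ preimage-cong f∘h≗id p ⟩
  preimage (λ x → x) p      ≡⟨ preimage-id p ⟩
  p                         ∎
  where open ≡-Reasoning

module _ {n : ℕ} where

  preimage-∘ₚ : ∀ (σ τ : Permutation′ n) p →
                preimage ((σ ∘ₚ τ) ⟨$⟩ʳ_) p ≡ preimage (σ ⟨$⟩ʳ_) (preimage (τ ⟨$⟩ʳ_) p)
  preimage-∘ₚ σ τ = preimage-∘ (τ ⟨$⟩ʳ_) (σ ⟨$⟩ʳ_)

  preimage-flip : ∀ (σ : Permutation′ n) p → preimage (flip σ ⟨$⟩ʳ_) (preimage (σ ⟨$⟩ʳ_) p) ≡ p
  preimage-flip σ = preimage-inverse {f = σ ⟨$⟩ʳ_} {h = σ ⟨$⟩ˡ_} (λ _ → inverseʳ σ)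

∣tabulate∣ : ∀ {n} (f : Fin n → Bool) →
             ∣ Vec.tabulate f ∣ ≡ FinSum.sum (λ i → if f i then 1 else 0)
∣tabulate∣ {zero}  f = refl
∣tabulate∣ {suc n} f with f zero
... | true  = cong suc (∣tabulate∣ (f ∘ suc))
... | false = ∣tabulate∣ (f ∘ suc)

∣tabulate∘does∣ : ∀ {n} {P : Pred A 0ℓ} (P? : Decidable P) (f : Fin n → A) →
                  ∣ Vec.tabulate (λ x → does (P? (f x))) ∣ ≡ length (filter P? (List.tabulate f))
∣tabulate∘does∣ {n = zero}  P? f = refl
∣tabulate∘does∣ {n = suc n} P? f with does (P? (f zero))
... | true  = cong suc (∣tabulate∘does∣ P? (f ∘ suc))
... | false = ∣tabulate∘does∣ P? (f ∘ suc)

∣preimage∣ : ∀ {n} (σ : Permutation′ n) p → ∣ preimage (σ ⟨$⟩ʳ_) p ∣ ≡ ∣ p ∣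
∣preimage∣ σ p = begin
  ∣ preimage (σ ⟨$⟩ʳ_) p ∣
    ≡⟨ ∣tabulate∣ (λ x → Vec.lookup p (σ ⟨$⟩ʳ x)) ⟩
  FinSum.sum (λ x → if Vec.lookup p (σ ⟨$⟩ʳ x) then 1 else 0)
    ≡⟨ FinSum.sum-permute _ σ ⟨
  FinSum.sum (λ x → if Vec.lookup p x then 1 else 0)
    ≡⟨ ∣tabulate∣ (Vec.lookup p) ⟨
  ∣ Vec.tabulate (Vec.lookup p) ∣
    ≡⟨ cong ∣_∣ (Vecₚ.tabulate∘lookup p) ⟩
  ∣ p ∣ ∎
  where open ≡-Reasoning

MapsOnto⇔preimage≡ : ∀ {n} {σ : Permutation′ n} {p q} → MapsOnto σ p q ⇔ preimage (σ ⟨$⟩ʳ_) q ≡ p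
MapsOnto⇔preimage≡ {σ = σ} = mk⇔
  (λ onto → ⊆-antisym (λ x∈ → proj₂ (onto _) (∈-preimage⁻ {f = σ ⟨$⟩ʳ_} x∈))
                      (λ x∈ → ∈-preimage⁺ {f = σ ⟨$⟩ʳ_} (proj₁ (onto _) x∈)))
  (λ { refl x → ∈-preimage⁻ {f = σ ⟨$⟩ʳ_} , ∈-preimage⁺ {f = σ ⟨$⟩ʳ_} })

count-preimage : ∀ {n} (σ : Permutation′ n) {P : Pred (Subset n) 0ℓ} (P? : Decidable P) →
                 count (P? ∘ preimage (σ ⟨$⟩ʳ_)) (subsets n) ≡ count P? (subsets n)
count-preimage {n} σ {P} P? =
  count-≡-inverses (subsets-unique n) ∈-subsets (P? ∘ preimage (σ ⟨$⟩ʳ_)) P?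
  (preimage (σ ⟨$⟩ʳ_)) (preimage (flip σ ⟨$⟩ʳ_)) (λ Pσp → Pσp)
  (λ {q} Pq → subst P (sym (preimage-flip (flip σ) q)) Pq)
  (λ {p} _ → preimage-flip σ p) (λ {q} _ → preimage-flip (flip σ) q)

-- Cycles of a permutation

module Cycles {n : ℕ} (g : Permutation′ n) where

  iter-+ : ∀ k l x → iter g (k + l) x ≡ iter g k (iter g l x)
  iter-+ zero    l x = refl
  iter-+ (suc k) l x = cong (g ⟨$⟩ʳ_) (iter-+ k l x)

  iter-injective : ∀ k {x y} → iter g k x ≡ iter g k y → x ≡ y
  iter-injective zero    eq = eq
  iter-injective (suc k) eq =
    iter-injective k (trans (sym (inverseˡ g)) (trans (cong (g ⟨$⟩ˡ_) eq) (inverseˡ g)))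

  iter-* : ∀ {p x} → iter g p x ≡ x → ∀ q → iter g (q * p) x ≡ x
  iter-* gᵖx≡x zero            = refl
  iter-* {p} {x} gᵖx≡x (suc q) = begin
    iter g (p + q * p) x         ≡⟨ iter-+ p (q * p) x ⟩
    iter g p (iter g (q * p) x)  ≡⟨ cong (iter g p) (iter-* gᵖx≡x q) ⟩
    iter g p x                   ≡⟨ gᵖx≡x ⟩
    x                            ∎
    where open ≡-Reasoning

  period : ∀ x → ∃[ p ] (0 < p × p ≤ n × iter g p x ≡ x)
  period x with i , j , i<j , gⁱx≡gʲx ← Finₚ.pigeonhole (n<1+n n) (λ k → iter g (toℕ k) x) =
    p , m<n⇒0<n∸m i<j , ≤-trans (m∸n≤m (toℕ j) (toℕ i)) (s≤s⁻¹ (Finₚ.toℕ<n j)) ,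
    sym (iter-injective (toℕ i) (begin
      iter g (toℕ i) x             ≡⟨ gⁱx≡gʲx ⟩
      iter g (toℕ j) x             ≡⟨ cong (λ k → iter g k x) (m+[n∸m]≡n (<⇒≤ i<j)) ⟨
      iter g (toℕ i + p) x         ≡⟨ iter-+ (toℕ i) p x ⟩
      iter g (toℕ i) (iter g p x)  ∎))
    where
    open ≡-Reasoning
    p : ℕ
    p = toℕ j ∸ toℕ i

  iter-bounded : ∀ k x → ∃[ j ] iter g k x ≡ iter g (toℕ j) x
  iter-bounded k x with p , p>0 , p≤n , gᵖx≡x ← period x =
    reduce p≤n gᵖx≡x {{>-nonZero p>0}}
    where
    reduce : ∀ {p} → p ≤ n → iter g p x ≡ x → .{{NonZero p}} →
             ∃[ j ] iter g k x ≡ iter g (toℕ j) x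
    reduce {p} p≤n gᵖx≡x = Fin.fromℕ< k%p<n , (begin
      iter g k x                            ≡⟨ cong (λ m → iter g m x) (m≡m%n+[m/n]*n k p) ⟩
      iter g (k % p + k / p * p) x          ≡⟨ iter-+ (k % p) (k / p * p) x ⟩
      iter g (k % p) (iter g (k / p * p) x) ≡⟨ cong (iter g (k % p)) (iter-* gᵖx≡x (k / p)) ⟩
      iter g (k % p) x                      ≡⟨ cong (λ m → iter g m x) (Finₚ.toℕ-fromℕ< k%p<n) ⟨
      iter g (toℕ (Fin.fromℕ< k%p<n)) x    ∎)
      where
      open ≡-Reasoning
      k%p<n : k % p < n
      k%p<n = ≤-trans (m%n<n k p) p≤n

  SameCycle : Fin n → Fin n → Set
  SameCycle x y = ∃[ k ] iter g k x ≡ y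

  SameCycle-refl : ∀ {x} → SameCycle x x
  SameCycle-refl = 0 , refl

  SameCycle-step : ∀ x → SameCycle x (g ⟨$⟩ʳ x)
  SameCycle-step x = 1 , refl

  SameCycle-trans : ∀ {x y z} → SameCycle x y → SameCycle y z → SameCycle x z
  SameCycle-trans {x} (k , refl) (l , refl) = l + k , iter-+ l k x

  -- If p is a period of x then g^(kp − k) (g^k x) = g^(kp) x = x.
  SameCycle-sym : ∀ {x y} → SameCycle x y → SameCycle y x
  SameCycle-sym {x} (k , refl) with p , p>0 , _ , gᵖx≡x ← period x =
    k * p ∸ k , (begin
      iter g (k * p ∸ k) (iter g k x) ≡⟨ iter-+ (k * p ∸ k) k x ⟨
      iter g (k * p ∸ k + k) x        ≡⟨ cong (λ m → iter g m x)
                                            (m∸n+n≡m (m≤m*n k p {{>-nonZero p>0}})) ⟩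
      iter g (k * p) x                ≡⟨ iter-* gᵖx≡x k ⟩
      x                               ∎)
    where open ≡-Reasoning

  iterates : Fin n → List (Fin n)
  iterates x = List.tabulate (λ (k : Fin n) → iter g (toℕ k) x)

  cycleMin : Fin n → Fin n
  cycleMin x = argmin toℕ x (iterates x)

  SameCycle-cycleMin : ∀ x → SameCycle x (cycleMin x)
  SameCycle-cycleMin x =
    argmin-all toℕ {xs = iterates x} {P = SameCycle x} SameCycle-refl
      (Allₚ.tabulate⁺ (λ k → toℕ k , refl))

  cycleMin-≤ : ∀ {x y} → SameCycle x y → toℕ (cycleMin x) ≤ toℕ y
  cycleMin-≤ {x} (k , refl) with j , gᵏx≡gʲx ← iter-bounded k x rewrite gᵏx≡gʲx =
    Allₚ.tabulate⁻ (f[argmin]≤f[xs] {f = toℕ} x (iterates x)) j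

  cycleMin-cong : ∀ {x y} → SameCycle x y → cycleMin x ≡ cycleMin y
  cycleMin-cong {x} {y} x~y = Finₚ.toℕ-injective (≤-antisym
    (cycleMin-≤ (SameCycle-trans x~y (SameCycle-cycleMin y)))
    (cycleMin-≤ (SameCycle-trans (SameCycle-sym x~y) (SameCycle-cycleMin x))))

  cycleMin-IsCycleMin : ∀ x → IsCycleMin g (cycleMin x)
  cycleMin-IsCycleMin x k = cycleMin-≤ (SameCycle-trans (SameCycle-cycleMin x) (toℕ k , refl))

  IsCycleMin⇒cycleMin≡ : ∀ {x} → IsCycleMin g x → cycleMin x ≡ x
  IsCycleMin⇒cycleMin≡ {x} x-min
    with k , gᵏx≡min ← SameCycle-cycleMin x
    with j , gᵏx≡gʲx ← iter-bounded k x =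
    Finₚ.toℕ-injective (≤-antisym (cycleMin-≤ SameCycle-refl)
      (subst (λ y → toℕ x ≤ toℕ y) (trans (sym gᵏx≡gʲx) gᵏx≡min) (x-min j)))

  cycleMins : Subset n
  cycleMins = Vec.tabulate (λ x → does (isCycleMin? g x))

  ∈-cycleMins⁺ : ∀ {x} → IsCycleMin g x → x Subset.∈ cycleMins
  ∈-cycleMins⁺ {x} x-min =
    Vecₚ.lookup⇒[]= x cycleMins (trans (Vecₚ.lookup∘tabulate _ x) (dec-true (isCycleMin? g x) x-min))

  ∈-cycleMins⁻ : ∀ {x} → x Subset.∈ cycleMins → IsCycleMin g x
  ∈-cycleMins⁻ {x} x∈ = invert (subst (Reflects (IsCycleMin g x))
    (trans (sym (Vecₚ.lookup∘tabulate _ x)) (Vecₚ.[]=⇒lookup x∈)) (proof (isCycleMin? g x)))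

  ∣cycleMins∣ : ∣ cycleMins ∣ ≡ cycles g
  ∣cycleMins∣ = ∣tabulate∘does∣ (isCycleMin? g) (λ x → x)

  Fixed : Pred (Subset n) 0ℓ
  Fixed p = preimage (g ⟨$⟩ʳ_) p ≡ p

  fixed? : Decidable Fixed
  fixed? p = preimage (g ⟨$⟩ʳ_) p ≟ₛ p

  Fixed-SameCycle : ∀ {p} → Fixed p → ∀ {x y} → SameCycle x y → x Subset.∈ p → y Subset.∈ p
  Fixed-SameCycle fixed (zero  , refl) x∈ = x∈
  Fixed-SameCycle fixed (suc k , refl) x∈ =
    ∈-preimage⁻ {f = g ⟨$⟩ʳ_}
      (subst (iter g k _ Subset.∈_) (sym fixed) (Fixed-SameCycle fixed (k , refl) x∈))

  -- A fixed subset is the union of the cycles through its cycle minima.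
  count-Fixed : count fixed? (subsets n) ≡ 2 ^ cycles g
  count-Fixed = begin
    count fixed? (subsets n)
      ≡⟨ count-≡-inverses (subsets-unique n) ∈-subsets fixed? (_⊆? cycleMins)
           (_∩ cycleMins) (preimage cycleMin)
           (λ {p} _ → p∩q⊆q p cycleMins) lift-Fixed lift∘restrict restrict∘lift ⟩
    count (_⊆? cycleMins) (subsets n)
      ≡⟨ count-⊆ cycleMins ⟩
    2 ^ ∣ cycleMins ∣
      ≡⟨ cong (2 ^_) ∣cycleMins∣ ⟩
    2 ^ cycles g ∎
    where
    open ≡-Reasoning
    lift-Fixed : ∀ {q} → q ⊆ cycleMins → Fixed (preimage cycleMin q)
    lift-Fixed {q} _ = begin
      preimage (g ⟨$⟩ʳ_) (preimage cycleMin q)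
        ≡⟨ preimage-∘ cycleMin (g ⟨$⟩ʳ_) q ⟨
      preimage (cycleMin ∘ (g ⟨$⟩ʳ_)) q
        ≡⟨ preimage-cong (λ x → cycleMin-cong (SameCycle-sym (SameCycle-step x))) q ⟩
      preimage cycleMin q ∎
    lift∘restrict : ∀ {p} → Fixed p → preimage cycleMin (p ∩ cycleMins) ≡ p
    lift∘restrict {p} fixed = ⊆-antisym
      (λ {x} x∈ → Fixed-SameCycle fixed (SameCycle-sym (SameCycle-cycleMin x))
                    (proj₁ (x∈p∩q⁻ p cycleMins (∈-preimage⁻ {f = cycleMin} x∈))))
      (λ {x} x∈ → ∈-preimage⁺ {f = cycleMin}
                    (x∈p∩q⁺ (Fixed-SameCycle fixed (SameCycle-cycleMin x) x∈ ,
                             ∈-cycleMins⁺ (cycleMin-IsCycleMin x))))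
    restrict∘lift : ∀ {q} → q ⊆ cycleMins → preimage cycleMin q ∩ cycleMins ≡ q
    restrict∘lift {q} q⊆ = ⊆-antisym
      (λ {x} x∈ → let x∈lift , x∈mins = x∈p∩q⁻ (preimage cycleMin q) cycleMins x∈ in
        subst (Subset._∈ q) (IsCycleMin⇒cycleMin≡ (∈-cycleMins⁻ x∈mins))
          (∈-preimage⁻ {f = cycleMin} x∈lift))
      (λ {x} x∈ → x∈p∩q⁺ (∈-preimage⁺ {f = cycleMin}
        (subst (Subset._∈ q) (sym (IsCycleMin⇒cycleMin≡ (∈-cycleMins⁻ (q⊆ x∈)))) x∈) , q⊆ x∈))

-- The action of a permutation group on subsets

≈ₚ-sym : ∀ {n} {σ τ : Permutation′ n} → σ ≈ₚ τ → τ ≈ₚ σ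
≈ₚ-sym σ≈τ x = sym (σ≈τ x)

≈ₚ-setoid : ℕ → Setoid 0ℓ 0ℓ
≈ₚ-setoid n = record
  { Carrier       = Permutation′ n
  ; _≈_           = _≈ₚ_
  ; isEquivalence = record
    { refl  = λ _ → refl
    ; sym   = λ {σ} {τ} → ≈ₚ-sym {n} {σ} {τ}
    ; trans = λ σ≈τ τ≈ρ x → trans (σ≈τ x) (τ≈ρ x)
    }
  }

module _ {n : ℕ} where

  ∘ₚ-cancelˡ : ∀ (ρ : Permutation′ n) {σ τ : Permutation′ n} →
               ρ ∘ₚ σ ≈ₚ ρ ∘ₚ τ → σ ≈ₚ τ
  ∘ₚ-cancelˡ ρ {σ} {τ} ρσ≈ρτ x = begin
    σ ⟨$⟩ʳ x                    ≡⟨ cong (σ ⟨$⟩ʳ_) (inverseʳ ρ) ⟨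
    σ ⟨$⟩ʳ (ρ ⟨$⟩ʳ (ρ ⟨$⟩ˡ x))  ≡⟨ ρσ≈ρτ (ρ ⟨$⟩ˡ x) ⟩
    τ ⟨$⟩ʳ (ρ ⟨$⟩ʳ (ρ ⟨$⟩ˡ x))  ≡⟨ cong (τ ⟨$⟩ʳ_) (inverseʳ ρ) ⟩
    τ ⟨$⟩ʳ x                    ∎
    where open ≡-Reasoning

  PullsBack : Subset n → Subset n → Pred (Permutation′ n) 0ℓ
  PullsBack p q σ = preimage (σ ⟨$⟩ʳ_) p ≡ q

  pullsBack? : ∀ p q → Decidable (PullsBack p q)
  pullsBack? p q σ = preimage (σ ⟨$⟩ʳ_) p ≟ₛ q

  PullsBack-resp-≈ₚ : ∀ p q → PullsBack p q Respects (_≈ₚ_ {n} {n})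
  PullsBack-resp-≈ₚ p q {σ} {τ} σ≈τ =
    trans (sym (preimage-cong {f = σ ⟨$⟩ʳ_} {h = τ ⟨$⟩ʳ_} σ≈τ p))

module Action {n : ℕ} (G : List (Permutation′ n)) (isGroup : IsPermGroup G) where

  open IsPermGroup isGroup
  open SetoidMembership (≈ₚ-setoid n) using () renaming (_∈_ to _∈ₛ_)

  ∈ₛ⇒∈G : ∀ {σ} → σ ∈ₛ G → σ ∈G G
  ∈ₛ⇒∈G {σ} = Any.map (λ {τ} → ≈ₚ-sym {n} {σ} {τ})

  ∈G⇒∈ₛ : ∀ {σ} → σ ∈G G → σ ∈ₛ G
  ∈G⇒∈ₛ {σ} = Any.map (λ {τ} → ≈ₚ-sym {n} {τ} {σ})

  InOrbit : Subset n → Subset n → Set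
  InOrbit p q = ∃[ σ ] σ ∈G G × PullsBack p q σ

  InOrbit-sym : ∀ {p q} → InOrbit p q → InOrbit q p
  InOrbit-sym {p} (σ , σ∈ , refl) = flip σ , closed⁻¹ σ σ∈ , preimage-flip σ p

  InOrbit-trans : ∀ {p q r} → InOrbit p q → InOrbit q r → InOrbit p r
  InOrbit-trans {p} (σ , σ∈ , refl) (τ , τ∈ , refl) =
    τ ∘ₚ σ , closed∘ τ σ τ∈ σ∈ , preimage-∘ₚ τ σ p

  Any⇒InOrbit : ∀ p q → Any (PullsBack p q) G → InOrbit p q
  Any⇒InOrbit p q any with σ , σ∈ , eq ← find any = σ , Any.map (λ { refl _ → refl }) σ∈ , eq

  transporters : Subset n → Subset n → ℕ
  transporters p q = count (pullsBack? p q) G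

  stabiliser : Subset n → ℕ
  stabiliser p = transporters p p

  transporters-pos⇒InOrbit : ∀ {p q} → 1 ≤ transporters p q → InOrbit p q
  transporters-pos⇒InOrbit {p} {q} pos = Any⇒InOrbit p q (count-pos⇒Any (pullsBack? p q) pos)

  1≤stabiliser : ∀ p → 1 ≤ stabiliser p
  1≤stabiliser p = Any⇒count-pos (pullsBack? p p)
    (Any.map (λ {σ} σ≈id → trans (preimage-cong σ≈id p) (preimage-id p)) hasId)

  transporters-≤ : ∀ {ρ} → ρ ∈G G → ∀ p q →
                   transporters p q ≤ transporters p (preimage (ρ ⟨$⟩ʳ_) q)
  transporters-≤ {ρ} ρ∈ p q =
    count-≤-injection (≈ₚ-setoid n)
      (pullsBack? p q) (pullsBack? p ρ⁻¹q)
      (λ {σ} {τ} → PullsBack-resp-≈ₚ p q {σ} {τ}) (λ {σ} {τ} → PullsBack-resp-≈ₚ p ρ⁻¹q {σ} {τ})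
      distinct (ρ ∘ₚ_)
      (λ {σ} σ∈ _ → ∈G⇒∈ₛ {ρ ∘ₚ σ} (closed∘ ρ σ ρ∈ (∈ₛ⇒∈G {σ} σ∈)))
      (λ {σ} eq → trans (preimage-∘ₚ ρ σ p) (cong (preimage (ρ ⟨$⟩ʳ_)) eq))
      (λ {σ} {τ} _ _ → ∘ₚ-cancelˡ ρ {σ} {τ})
    where
    ρ⁻¹q : Subset n
    ρ⁻¹q = preimage (ρ ⟨$⟩ʳ_) q

  -- The transporters from p to an element of its orbit form a coset of the stabiliser of p.
  InOrbit⇒transporters≡stabiliser : ∀ {p q} → InOrbit p q → transporters p q ≡ stabiliser p
  InOrbit⇒transporters≡stabiliser {p} (τ , τ∈ , refl) = ≤-antisym
    (subst (λ r → transporters p (preimage (τ ⟨$⟩ʳ_) p) ≤ transporters p r) (preimage-flip τ p)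
      (transporters-≤ {flip τ} (closed⁻¹ τ τ∈) p (preimage (τ ⟨$⟩ʳ_) p)))
    (transporters-≤ {τ} τ∈ p p)

  transporters≤stabiliser : ∀ p q → transporters p q ≤ stabiliser p
  transporters≤stabiliser p q with Any.any? (pullsBack? p q) G
  ... | yes any = ≤-reflexive (InOrbit⇒transporters≡stabiliser (Any⇒InOrbit p q any))
  ... | no ¬any = subst (_≤ stabiliser p) (sym (¬Any⇒count≡0 (pullsBack? p q) ¬any)) z≤n

  F₂≡∑stabiliser : F G 2 ≡ ∑[ p ∈ subsets n ] stabiliser p
  F₂≡∑stabiliser = begin
    ∑[ σ ∈ G ] 2 ^ cycles σ
      ≡⟨ ∑-cong G (λ {σ} _ → sym (Cycles.count-Fixed σ)) ⟩
    ∑[ σ ∈ G ] count (Cycles.fixed? σ) (subsets n)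
      ≡⟨ ∑-comm _ G (subsets n) ⟩
    ∑[ p ∈ subsets n ] stabiliser p ∎
    where open ≡-Reasoning

  [n+1]|G|≡∑transporters : (n + 1) * order G ≡ ∑[ p ∈ subsets n ] transporters p (initial n ∣ p ∣)
  [n+1]|G|≡∑transporters = begin
    (n + 1) * length G
      ≡⟨ *-comm (n + 1) (length G) ⟩
    length G * (n + 1)
      ≡⟨ ∑-const (n + 1) G ⟨
    ∑[ σ ∈ G ] (n + 1)
      ≡⟨ ∑-cong G (λ {σ} _ → count-IsInitial∘preimage σ) ⟨
    ∑[ σ ∈ G ] count (isInitial? ∘ preimage (σ ⟨$⟩ʳ_)) S
      ≡⟨ ∑-comm _ G S ⟩
    ∑[ p ∈ S ] count (λ σ → isInitial? (preimage (σ ⟨$⟩ʳ_) p)) G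
      ≡⟨ ∑-cong S (λ {p} _ → IsInitial≐PullsBack p) ⟩
    ∑[ p ∈ S ] transporters p (initial n ∣ p ∣) ∎
    where
    open ≡-Reasoning
    S : List (Subset n)
    S = subsets n
    count-IsInitial∘preimage : ∀ σ → count (isInitial? ∘ preimage (σ ⟨$⟩ʳ_)) S ≡ n + 1
    count-IsInitial∘preimage σ =
      trans (count-preimage σ isInitial?) (trans (count-IsInitial n) (+-comm 1 n))
    IsInitial≐PullsBack : ∀ p → count (λ σ → isInitial? (preimage (σ ⟨$⟩ʳ_) p)) G ≡
                                transporters p (initial n ∣ p ∣)
    IsInitial≐PullsBack p =
      count-cong (λ σ → isInitial? (preimage (σ ⟨$⟩ʳ_) p)) (pullsBack? p (initial n ∣ p ∣))
      (λ {σ} eq → trans eq (cong (initial n) (∣preimage∣ σ p)))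
      (λ {σ} eq → trans eq (cong (initial n) (sym (∣preimage∣ σ p)))) G

  [n+1]|G|≤F₂ : (n + 1) * order G ≤ F G 2
  [n+1]|G|≤F₂ = begin
    (n + 1) * order G
      ≡⟨ [n+1]|G|≡∑transporters ⟩
    ∑[ p ∈ subsets n ] transporters p (initial n ∣ p ∣)
      ≤⟨ ∑-mono-≤ (subsets n) (λ p → transporters≤stabiliser p _) ⟩
    ∑[ p ∈ subsets n ] stabiliser p
      ≡⟨ F₂≡∑stabiliser ⟨
    F G 2 ∎
    where open ≤-Reasoning

  F₂≡⇔InOrbit-initial : F G 2 ≡ (n + 1) * order G ⇔ (∀ p → InOrbit p (initial n ∣ p ∣))
  F₂≡⇔InOrbit-initial = mk⇔
    (λ eq p → transporters-pos⇒InOrbit {p} {initial n ∣ p ∣}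
                (subst (1 ≤_) (sym (pointwise eq p)) (1≤stabiliser p)))
    (λ inOrbit → trans F₂≡∑stabiliser (trans
      (∑-cong (subsets n) (λ {p} _ → sym (InOrbit⇒transporters≡stabiliser (inOrbit p))))
      (sym [n+1]|G|≡∑transporters)))
    where
    pointwise : F G 2 ≡ (n + 1) * order G → ∀ p → transporters p (initial n ∣ p ∣) ≡ stabiliser p
    pointwise eq p = ∑-mono-≤-equality (subsets n) (λ p → transporters≤stabiliser p _)
      (trans (sym [n+1]|G|≡∑transporters) (trans (sym eq) F₂≡∑stabiliser)) (∈-subsets p)

  SetTransitive⇔InOrbit-initial : SetTransitive G ⇔ (∀ p → InOrbit p (initial n ∣ p ∣))
  SetTransitive⇔InOrbit-initial = mk⇔ inOrbit-initial setTransitive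
    where
    inOrbit-initial : SetTransitive G → ∀ p → InOrbit p (initial n ∣ p ∣)
    inOrbit-initial st p
      with σ , σ∈ , onto ← st ∣ p ∣ (∣p∣≤n p) (initial n ∣ p ∣) p (∣initial∣ (∣p∣≤n p)) refl =
      σ , σ∈ , Equivalence.to (MapsOnto⇔preimage≡ {σ = σ} {initial n ∣ p ∣} {p}) onto
    setTransitive : (∀ p → InOrbit p (initial n ∣ p ∣)) → SetTransitive G
    setTransitive inOrbit i _ p q ∣p∣≡i ∣q∣≡i
      with σ , σ∈ , eq ← InOrbit-trans {q} {initial n ∣ q ∣} {p} (inOrbit q)
             (subst (λ k → InOrbit (initial n k) p) (trans ∣p∣≡i (sym ∣q∣≡i))
               (InOrbit-sym {p} {initial n ∣ p ∣} (inOrbit p))) =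
      σ , σ∈ , Equivalence.from (MapsOnto⇔preimage≡ {σ = σ} {p} {q}) eq

F-zero : ∀ {n} (G : List (Permutation′ (suc n))) → F G 0 ≡ 0
F-zero G =
  trans (∑-cong G (λ {σ} _ → cong (0 ^_) (cycles-suc σ))) (trans (∑-const 0 G) (*-zeroʳ (length G)))
  where
  cycles-suc : ∀ σ → cycles σ ≡ suc (length (filter (isCycleMin? σ) (List.tabulate suc)))
  cycles-suc σ = cong length (filter-accept (isCycleMin? σ) (λ _ → z≤n))

F-one : ∀ {n} (G : List (Permutation′ n)) → F G 1 ≡ order G
F-one G =
  trans (∑-cong G (λ {σ} _ → ^-zeroˡ (cycles σ))) (trans (∑-const 1 G) (*-identityʳ (length G)))

mainTheorem5 : (n : ℕ) → n ≥ 1 → (G : List (Permutation′ n)) → IsPermGroup G →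
    (F G 0 ≡ 0) × (F G 1 ≡ order G) × (F G 2 ≥ (n + 1) * order G)
    × ((F G 2 ≡ (n + 1) * order G) ⇔ SetTransitive G)
mainTheorem5 (suc n) _ G isGroup =
  F-zero G , F-one G , [n+1]|G|≤F₂ , ⇔-sym SetTransitive⇔InOrbit-initial ⇔-∘ F₂≡⇔InOrbit-initial
  where open Action G isGroup
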